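{- Let $d\ge 3$, let $p$ be a prime, let $N\le p$ be a positive integer, and let $\vec h=(h_1,\dots,h_d)\in\mathbb{F}_p^d$ be such that the smallest index $\ell$ with $h_\ell\ne0$ satisfies $\ell<d$. Then for any positive integer $s<d$, \[ R_{d,s}(N;\vec h)\ll N^{s-1/2}, \] where the implied constant depends only on $d$.
   Context: For $\vec h=(h_1,\dots,h_d)\in\mathbb{F}_p^d$ and positive integers $N,s$, $R_{d,s}(N;\vec h)$ denotes the number of solutions of the system of congruences \[ n_1^\nu+\dots+n_s^\nu\equiv n_{s+1}^\nu+\dots+n_{2s}^\nu+h_\nu \pmod p,\qquad \nu=1,\dots,d, \] in integers $1\le n_i\le N$, $i=1,\dots,2s$. -}

module Defs where

open import Data.Nat using (ℕ; zero; suc; _+_; _^_; ∣_-_∣)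
open import Data.Nat.Divisibility using (_∣_; _∣?_)
open import Data.Fin using (Fin; toℕ)
open import Data.List using (List; []; _∷_; map; concatMap; length; filter; upTo; allFin)
open import Data.Nat.ListAction using (sum)
open import Data.Bool.ListAction using (all)
open import Data.Vec using (Vec; []; _∷_; toList)
open import Data.Product using (_×_; _,_)
open import Data.Bool using (Bool; T?)
open import Relation.Nullary.Decidable using (⌊_⌋)

congB : ℕ → ℕ → ℕ → Bool
congB p a b = ⌊ p ∣? ∣ a - b ∣ ⌋

tuples : (k N : ℕ) → List (Vec ℕ k)
tuples zero N = [] ∷ []
tuples (suc k) N = concatMap (λ x → map (x ∷_) (tuples k N)) (map suc (upTo N))

powSum : {k : ℕ} → ℕ → Vec ℕ k → ℕ
powSum ν v = sum (map (λ x → x ^ ν) (toList v))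

-- the system n₁^ν+…+n_s^ν ≡ n_{s+1}^ν+…+n_{2s}^ν + h_ν (mod p), ν = 1,…,d
-- (h : Fin d → Fin p, with index i : Fin d standing for ν = toℕ i + 1)
solves : (d p s : ℕ) → (Fin d → Fin p) → Vec ℕ s × Vec ℕ s → Bool
solves d p s h (x , y) =
  all (λ i → congB p (powSum (suc (toℕ i)) x) (powSum (suc (toℕ i)) y + toℕ (h i))) (allFin d)

tuplePairs : (s N : ℕ) → List (Vec ℕ s × Vec ℕ s)
tuplePairs s N = concatMap (λ x → map (x ,_) (tuples s N)) (tuples s N)

R : (d s N p : ℕ) → (Fin d → Fin p) → ℕ
R d s N p h = length (filter (λ xy → T? (solves d p s h xy)) (tuplePairs s N))

{-# OPTIONS --safe #-}

-- Write e(x) = ∏ (1 - xᵢ T), P(x) = Σₖ pₖ(x) Tᵏ for the power sums, H = Σₖ hₖ Tᵏ and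
-- θ = T d/dT.  Newton's identities read θ e(x) = - P(x) e(x).  When d < p the equation
-- θ E = H E, E₀ = 1 has a unique solution modulo (p, T^(d+1)), as the recursion for the
-- coefficients only divides by 1, …, d.  For a solution (x, y) of the system both e(y) and
-- e(x) E then solve θ F = (H - P(x)) F, so e(y) ≡ e(x) E modulo (p, T^(d+1)).
-- Consequently, for fixed x all solutions y share e(y) up to degree s, so their entries are
-- roots of one polynomial of degree s and there are at most sˢ of them; and a solution exists
-- only if the coefficient of T^j₀ in e(x) E vanishes for a fixed s < j₀ ≤ d.  That coefficient
-- is affine in each xᵢ and is not identically zero because E_ℓ = h_ℓ / ℓ ≢ 0 for the first ℓ
-- with h_ℓ ≢ 0, so it vanishes for at most s N^(s-1) tuples x.  Hence R ≤ s^(s+1) N^(s-1).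
-- When p ≤ d we have N ≤ d, and the trivial bound R ≤ N^(2s) suffices.

module Submission where

open import Data.Nat as ℕ using (ℕ; zero; suc)
import Data.Nat.Properties as ℕₚ
open import Data.Nat.Primality using (Prime)
open import Data.Fin using (Fin)
open import Data.Vec using (Vec; []; _∷_)
open import Function using (_∘_)
open import Relation.Binary.PropositionalEquality
open import Defs

module PowerSeries where

  open import Data.Integer using (ℤ; +_; _+_; _*_; -_; _-_; 0ℤ; 1ℤ)
  import Data.Integer.Properties as ℤₚ
  open import Data.Integer.Tactic.RingSolver using (solve-∀)
  open import Data.Vec.Membership.Propositional using () renaming (_∈_ to _∈ᵥ_)
  open import Data.Vec.Relation.Unary.Any using (here; there)
  open ≡-Reasoning

  Series : Set
  Series = ℕ → ℤ

  infixl 7 _⊛_ _·_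
  infixl 6 _⊕_

  _⊕_ : Series → Series → Series
  (f ⊕ g) k = f k + g k

  _·_ : ℤ → Series → Series
  (c · f) k = c * f k

  -- Cauchy product: (f ⊛ g) k = Σ_{i ≤ k} f i * g (k - i)
  _⊛_ : Series → Series → Series
  (f ⊛ g) zero    = f 0 * g 0
  (f ⊛ g) (suc k) = f 0 * g (suc k) + ((f ∘ suc) ⊛ g) k

  one : Series
  one zero    = 1ℤ
  one (suc _) = 0ℤ

  θ : Series → Series
  θ f k = + k * f k

  ⊛-cong : ∀ {f f′ g g′} → f ≗ f′ → g ≗ g′ → f ⊛ g ≗ f′ ⊛ g′
  ⊛-cong f≗ g≗ zero    = cong₂ _*_ (f≗ 0) (g≗ 0)
  ⊛-cong f≗ g≗ (suc k) = cong₂ _+_ (cong₂ _*_ (f≗ 0) (g≗ (suc k))) (⊛-cong (f≗ ∘ suc) g≗ k)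

  ⊛-zeroˡ : ∀ f g → (∀ i → f i ≡ 0ℤ) → ∀ k → (f ⊛ g) k ≡ 0ℤ
  ⊛-zeroˡ f g f≡0 zero    rewrite f≡0 0 = refl
  ⊛-zeroˡ f g f≡0 (suc k) rewrite f≡0 0 = trans (ℤₚ.+-identityˡ _) (⊛-zeroˡ (f ∘ suc) g (f≡0 ∘ suc) k)

  ⊛-identityˡ : ∀ f → one ⊛ f ≗ f
  ⊛-identityˡ f zero    = ℤₚ.*-identityˡ (f 0)
  ⊛-identityˡ f (suc k) = begin
    1ℤ * f (suc k) + ((one ∘ suc) ⊛ f) k
      ≡⟨ cong₂ _+_ (ℤₚ.*-identityˡ (f (suc k))) (⊛-zeroˡ (one ∘ suc) f (λ _ → refl) k) ⟩
    f (suc k) + 0ℤ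
      ≡⟨ ℤₚ.+-identityʳ (f (suc k)) ⟩
    f (suc k)
      ∎

  ⊛-distribʳ-⊕ : ∀ f g h → (f ⊕ g) ⊛ h ≗ f ⊛ h ⊕ g ⊛ h
  ⊛-distribʳ-⊕ f g h zero    = ℤₚ.*-distribʳ-+ (h 0) (f 0) (g 0)
  ⊛-distribʳ-⊕ f g h (suc k) rewrite ⊛-distribʳ-⊕ (f ∘ suc) (g ∘ suc) h k =
    shuffle (f 0) (g 0) (h (suc k)) _ _
    where
    shuffle : ∀ a b c x y → (a + b) * c + (x + y) ≡ (a * c + x) + (b * c + y)
    shuffle = solve-∀

  ·-⊛ : ∀ c f g → (c · f) ⊛ g ≗ c · (f ⊛ g)
  ·-⊛ c f g zero    = ℤₚ.*-assoc c (f 0) (g 0)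
  ·-⊛ c f g (suc k) rewrite ·-⊛ c (f ∘ suc) g k = factor c (f 0) (g (suc k)) _
    where
    factor : ∀ c a b x → c * a * b + c * x ≡ c * (a * b + x)
    factor = solve-∀

  ⊛-comm : ∀ f g → f ⊛ g ≗ g ⊛ f
  ⊛-comm f g zero          = ℤₚ.*-comm (f 0) (g 0)
  ⊛-comm f g (suc zero)    = swap (f 0) (g 1) (f 1) (g 0)
    where
    swap : ∀ a b c d → a * b + c * d ≡ d * c + b * a
    swap = solve-∀
  ⊛-comm f g (suc (suc k)) = begin
    f 0 * g (suc (suc k)) + ((f ∘ suc) ⊛ g) (suc k)
      ≡⟨ cong (_+_ (f 0 * g (suc (suc k)))) (⊛-comm (f ∘ suc) g (suc k)) ⟩
    f 0 * g (suc (suc k)) + (g 0 * f (suc (suc k)) + ((g ∘ suc) ⊛ (f ∘ suc)) k)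
      ≡⟨ cong (λ u → f 0 * g (suc (suc k)) + (g 0 * f (suc (suc k)) + u)) (⊛-comm (g ∘ suc) (f ∘ suc) k) ⟩
    f 0 * g (suc (suc k)) + (g 0 * f (suc (suc k)) + ((f ∘ suc) ⊛ (g ∘ suc)) k)
      ≡⟨ exchange (f 0 * g (suc (suc k))) (g 0 * f (suc (suc k))) _ ⟩
    g 0 * f (suc (suc k)) + (f 0 * g (suc (suc k)) + ((f ∘ suc) ⊛ (g ∘ suc)) k)
      ≡⟨ cong (_+_ (g 0 * f (suc (suc k)))) (⊛-comm f (g ∘ suc) (suc k)) ⟩
    g 0 * f (suc (suc k)) + ((g ∘ suc) ⊛ f) (suc k)
      ∎
    where
    exchange : ∀ a b c → a + (b + c) ≡ b + (a + c)
    exchange = solve-∀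

  ⊛-assoc : ∀ f g h → (f ⊛ g) ⊛ h ≗ f ⊛ (g ⊛ h)
  ⊛-assoc f g h zero    = ℤₚ.*-assoc (f 0) (g 0) (h 0)
  ⊛-assoc f g h (suc k) = begin
    f 0 * g 0 * h (suc k) + (((f ⊛ g) ∘ suc) ⊛ h) k
      ≡⟨ cong (_+_ (f 0 * g 0 * h (suc k))) (⊛-distribʳ-⊕ (f 0 · (g ∘ suc)) ((f ∘ suc) ⊛ g) h k) ⟩
    f 0 * g 0 * h (suc k) + (((f 0 · (g ∘ suc)) ⊛ h) k + (((f ∘ suc) ⊛ g) ⊛ h) k)
      ≡⟨ cong₂ (λ u v → f 0 * g 0 * h (suc k) + (u + v)) (·-⊛ (f 0) (g ∘ suc) h k) (⊛-assoc (f ∘ suc) g h k) ⟩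
    f 0 * g 0 * h (suc k) + (f 0 * ((g ∘ suc) ⊛ h) k + ((f ∘ suc) ⊛ (g ⊛ h)) k)
      ≡⟨ factor (f 0) (g 0) (h (suc k)) _ _ ⟩
    f 0 * (g 0 * h (suc k) + ((g ∘ suc) ⊛ h) k) + ((f ∘ suc) ⊛ (g ⊛ h)) k
      ∎
    where
    factor : ∀ a b c x y → a * b * c + (a * x + y) ≡ a * (b * c + x) + y
    factor = solve-∀

  -- the step uses (θ f) ∘ suc = θ (f ∘ suc) ⊕ f ∘ suc
  θ-⊛ : ∀ f g → θ (f ⊛ g) ≗ θ f ⊛ g ⊕ f ⊛ θ g
  θ-⊛ f g zero    = leibniz₀ (f 0) (g 0)
    where
    leibniz₀ : ∀ a b → 0ℤ * (a * b) ≡ 0ℤ * a * b + a * (0ℤ * b)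
    leibniz₀ = solve-∀
  θ-⊛ f g (suc k) = begin
    + suc k * (f 0 * g (suc k) + c)
      ≡⟨ expand (+ k) (f 0) (g (suc k)) c ⟩
    + k * c + c + f 0 * (+ suc k * g (suc k))
      ≡⟨ cong (λ u → u + c + f 0 * (+ suc k * g (suc k))) (θ-⊛ (f ∘ suc) g k) ⟩
    (θ (f ∘ suc) ⊛ g) k + ((f ∘ suc) ⊛ θ g) k + c + f 0 * (+ suc k * g (suc k))
      ≡⟨ cong (_+ f 0 * (+ suc k * g (suc k))) (regroup ((θ (f ∘ suc) ⊛ g) k) (((f ∘ suc) ⊛ θ g) k) c) ⟩
    (θ (f ∘ suc) ⊛ g) k + c + ((f ∘ suc) ⊛ θ g) k + f 0 * (+ suc k * g (suc k))
      ≡⟨ cong (λ u → u + ((f ∘ suc) ⊛ θ g) k + f 0 * (+ suc k * g (suc k)))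
              (sym (⊛-distribʳ-⊕ (θ (f ∘ suc)) (f ∘ suc) g k)) ⟩
    ((θ (f ∘ suc) ⊕ f ∘ suc) ⊛ g) k + ((f ∘ suc) ⊛ θ g) k + f 0 * (+ suc k * g (suc k))
      ≡⟨ cong (λ u → u + ((f ∘ suc) ⊛ θ g) k + f 0 * (+ suc k * g (suc k)))
              (⊛-cong (λ i → θ-shift (+ i) (f (suc i))) (λ _ → refl) k) ⟩
    (((θ f) ∘ suc) ⊛ g) k + ((f ∘ suc) ⊛ θ g) k + f 0 * (+ suc k * g (suc k))
      ≡⟨ assemble (f 0) (g (suc k)) ((((θ f) ∘ suc) ⊛ g) k) _ (+ suc k * g (suc k)) ⟩
    (θ f 0 * g (suc k) + (((θ f) ∘ suc) ⊛ g) k) + (f 0 * θ g (suc k) + ((f ∘ suc) ⊛ θ g) k)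
      ∎
    where
    c = ((f ∘ suc) ⊛ g) k
    expand : ∀ K a b c → (1ℤ + K) * (a * b + c) ≡ K * c + c + a * ((1ℤ + K) * b)
    expand = solve-∀
    regroup : ∀ a b c → a + b + c ≡ a + c + b
    regroup = solve-∀
    θ-shift : ∀ I a → I * a + a ≡ (1ℤ + I) * a
    θ-shift = solve-∀
    assemble : ∀ a b x y z → x + y + a * z ≡ (0ℤ * a * b + x) + (a * z + y)
    assemble = solve-∀

  ⊛-collect : ∀ F G f g → (F ⊛ f) ⊛ g ⊕ f ⊛ (G ⊛ g) ≗ (F ⊕ G) ⊛ (f ⊛ g)
  ⊛-collect F G f g k = begin
    ((F ⊛ f) ⊛ g) k + (f ⊛ (G ⊛ g)) k
      ≡⟨ cong₂ _+_ (⊛-assoc F f g k) (trans (sym (⊛-assoc f G g k)) (⊛-cong (⊛-comm f G) (λ _ → refl) k)) ⟩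
    (F ⊛ (f ⊛ g)) k + ((G ⊛ f) ⊛ g) k
      ≡⟨ cong (_+_ ((F ⊛ (f ⊛ g)) k)) (⊛-assoc G f g k) ⟩
    (F ⊛ (f ⊛ g)) k + (G ⊛ (f ⊛ g)) k
      ≡⟨ sym (⊛-distribʳ-⊕ F G (f ⊛ g) k) ⟩
    ((F ⊕ G) ⊛ (f ⊛ g)) k
      ∎

  θ-⊛-logarithmic : ∀ {F G f g} → θ f ≗ F ⊛ f → θ g ≗ G ⊛ g → θ (f ⊛ g) ≗ (F ⊕ G) ⊛ (f ⊛ g)
  θ-⊛-logarithmic {F} {G} {f} {g} θf θg k = begin
    θ (f ⊛ g) k                          ≡⟨ θ-⊛ f g k ⟩
    (θ f ⊛ g) k + (f ⊛ θ g) k            ≡⟨ cong₂ _+_ (⊛-cong θf (λ _ → refl) k) (⊛-cong (λ _ → refl) θg k) ⟩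
    ((F ⊛ f) ⊛ g) k + (f ⊛ (G ⊛ g)) k    ≡⟨ ⊛-collect F G f g k ⟩
    ((F ⊕ G) ⊛ (f ⊛ g)) k                ∎

  ⊛-congʳ-upTo : ∀ f {g g′} k → (∀ i → i ℕ.≤ k → g i ≡ g′ i) → (f ⊛ g) k ≡ (f ⊛ g′) k
  ⊛-congʳ-upTo f zero    g≡ = cong (f 0 *_) (g≡ 0 ℕ.z≤n)
  ⊛-congʳ-upTo f (suc k) g≡ = cong₂ _+_ (cong (f 0 *_) (g≡ (suc k) ℕₚ.≤-refl))
    (⊛-congʳ-upTo (f ∘ suc) k (λ i i≤k → g≡ i (ℕₚ.m≤n⇒m≤1+n i≤k)))

  ⊛-suc-constantFree : ∀ f g k → f 0 ≡ 0ℤ → (f ⊛ g) (suc k) ≡ ((f ∘ suc) ⊛ g) k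
  ⊛-suc-constantFree f g k f₀≡0 rewrite f₀≡0 = ℤₚ.+-identityˡ _

  ⊛-vanishing-below : ∀ f g n → (∀ i → i ℕ.< n → f i ≡ 0ℤ) → (f ⊛ g) n ≡ f n * g 0
  ⊛-vanishing-below f g zero    _   = refl
  ⊛-vanishing-below f g (suc n) f≡0 rewrite f≡0 0 (ℕ.s≤s ℕ.z≤n) =
    trans (ℤₚ.+-identityˡ _) (⊛-vanishing-below (f ∘ suc) g n (λ i i<n → f≡0 (suc i) (ℕ.s≤s i<n)))

  linear : ℕ → Series
  linear t zero          = 1ℤ
  linear t (suc zero)    = - + t
  linear t (suc (suc _)) = 0ℤ

  linear-⊛ : ∀ t f k → (linear t ⊛ f) (suc k) ≡ f (suc k) - + t * f k
  linear-⊛ t f zero    = expand (+ t) (f 1) (f 0)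
    where
    expand : ∀ t a b → 1ℤ * a + (- t) * b ≡ a - t * b
    expand = solve-∀
  linear-⊛ t f (suc k) rewrite ⊛-zeroˡ (linear t ∘ suc ∘ suc) f (λ _ → refl) k =
    expand (+ t) (f (suc (suc k))) (f (suc k))
    where
    expand : ∀ t a b → 1ℤ * a + ((- t) * b + 0ℤ) ≡ a - t * b
    expand = solve-∀

  -- ∏ (1 - xᵢ T), whose k-th coefficient is (-1)ᵏ eₖ(x)
  elementary : ∀ {m} → Vec ℕ m → Series
  elementary []      = one
  elementary (t ∷ v) = linear t ⊛ elementary v

  elementary-zero : ∀ {m} (v : Vec ℕ m) → elementary v 0 ≡ 1ℤ
  elementary-zero []      = refl
  elementary-zero (t ∷ v) = trans (ℤₚ.*-identityˡ _) (elementary-zero v)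

  elementary-degree : ∀ {m} (v : Vec ℕ m) k → m ℕ.< k → elementary v k ≡ 0ℤ
  elementary-degree []      (suc k) _ = refl
  elementary-degree (t ∷ v) (suc k) (ℕ.s≤s m<k)
    rewrite linear-⊛ t (elementary v) k
          | elementary-degree v (suc k) (ℕₚ.m≤n⇒m≤1+n m<k)
          | elementary-degree v k m<k
    = cancel (+ t)
    where
    cancel : ∀ t → 0ℤ - t * 0ℤ ≡ 0ℤ
    cancel = solve-∀

  negPowerSums : ∀ {m} → Vec ℕ m → Series
  negPowerSums v zero    = 0ℤ
  negPowerSums v (suc k) = - + powSum (suc k) v

  θ-linear : ∀ t → θ (linear t) ≗ negPowerSums (t ∷ []) ⊛ linear t
  θ-linear t zero    = refl
  θ-linear t (suc k) = sym (begin
    (G ⊛ linear t) (suc k)         ≡⟨ ⊛-comm G (linear t) (suc k) ⟩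
    (linear t ⊛ G) (suc k)         ≡⟨ linear-⊛ t G k ⟩
    G (suc k) - + t * G k          ≡⟨ coefficient k ⟩
    θ (linear t) (suc k)           ∎)
    where
    G = negPowerSums (t ∷ [])
    G-suc : ∀ k → G (suc k) ≡ - (+ t * + (t ℕ.^ k))
    G-suc k = cong -_ (trans (cong +_ (ℕₚ.+-identityʳ (t ℕ.^ suc k))) (ℤₚ.pos-* t (t ℕ.^ k)))
    coefficient : ∀ k → G (suc k) - + t * G k ≡ θ (linear t) (suc k)
    coefficient zero    = trans (cong (λ a → a - + t * 0ℤ) (G-suc 0)) (cancel (+ t))
      where
      cancel : ∀ T → - (T * 1ℤ) - T * 0ℤ ≡ 1ℤ * (- T)
      cancel = solve-∀
    coefficient (suc k) = begin
      G (suc (suc k)) - + t * G (suc k)                   ≡⟨ cong₂ (λ a b → a - + t * b) (G-suc (suc k)) (G-suc k) ⟩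
      - (+ t * + (t ℕ.^ suc k)) - + t * - (+ t * A)       ≡⟨ cong (λ a → - (+ t * a) - + t * - (+ t * A)) (ℤₚ.pos-* t (t ℕ.^ k)) ⟩
      - (+ t * (+ t * A)) - + t * - (+ t * A)             ≡⟨ cancel (+ suc (suc k)) (+ t) A ⟩
      + suc (suc k) * 0ℤ                                  ∎
      where
      A = + (t ℕ.^ k)
      cancel : ∀ K T A → - (T * (T * A)) - T * - (T * A) ≡ K * 0ℤ
      cancel = solve-∀

  newton : ∀ {m} (v : Vec ℕ m) → θ (elementary v) ≗ negPowerSums v ⊛ elementary v
  newton []      zero    = refl
  newton []      (suc k) =
    trans (ℤₚ.*-zeroʳ (+ suc k)) (sym (⊛-zeroˡ (negPowerSums []) one (λ { zero → refl ; (suc _) → refl }) (suc k)))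
  newton (t ∷ v) k = begin
    θ (linear t ⊛ elementary v) k
      ≡⟨ θ-⊛-logarithmic (θ-linear t) (newton v) k ⟩
    ((negPowerSums (t ∷ []) ⊕ negPowerSums v) ⊛ elementary (t ∷ v)) k
      ≡⟨ ⊛-cong (negPowerSums-∷ t v) (λ _ → refl) k ⟩
    (negPowerSums (t ∷ v) ⊛ elementary (t ∷ v)) k
      ∎
    where
    negPowerSums-∷ : ∀ {m} t (v : Vec ℕ m) → negPowerSums (t ∷ []) ⊕ negPowerSums v ≗ negPowerSums (t ∷ v)
    negPowerSums-∷ t v zero    = refl
    negPowerSums-∷ t v (suc k) = begin
      - + (t ℕ.^ suc k ℕ.+ 0) + - + powSum (suc k) v
        ≡⟨ cong (λ a → - + a + - + powSum (suc k) v) (ℕₚ.+-identityʳ (t ℕ.^ suc k)) ⟩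
      - + (t ℕ.^ suc k) + - + powSum (suc k) v
        ≡⟨ sym (ℤₚ.neg-distrib-+ (+ (t ℕ.^ suc k)) (+ powSum (suc k) v)) ⟩
      - (+ (t ℕ.^ suc k) + + powSum (suc k) v)
        ≡⟨ cong -_ (sym (ℤₚ.pos-+ (t ℕ.^ suc k) (powSum (suc k) v))) ⟩
      - + (t ℕ.^ suc k ℕ.+ powSum (suc k) v)
        ∎

  evalReversed : ℕ → Series → ℤ → ℤ
  evalReversed zero    f u = f 0
  evalReversed (suc n) f u = u * evalReversed n f u + f (suc n)

  evalReversed-linear-⊛ : ∀ n t f u → evalReversed (suc n) (linear t ⊛ f) u ≡ (u - + t) * evalReversed n f u + f (suc n)
  evalReversed-linear-⊛ zero t f u rewrite linear-⊛ t f 0 = expand u (+ t) (f 0) (f 1)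
    where
    expand : ∀ u t a b → u * (1ℤ * a) + (b - t * a) ≡ (u - t) * a + b
    expand = solve-∀
  evalReversed-linear-⊛ (suc n) t f u rewrite evalReversed-linear-⊛ n t f u | linear-⊛ t f (suc n) =
    expand u (+ t) (evalReversed n f u) (f (suc n)) (f (suc (suc n)))
    where
    expand : ∀ u t e a b → u * ((u - t) * e + a) + (b - t * a) ≡ (u - t) * (u * e + a) + b
    expand = solve-∀

  ∏-diff : ∀ {m} → ℤ → Vec ℕ m → ℤ
  ∏-diff u []      = 1ℤ
  ∏-diff u (t ∷ v) = (u - + t) * ∏-diff u v

  evalReversed-elementary : ∀ {m} (v : Vec ℕ m) u → evalReversed m (elementary v) u ≡ ∏-diff u v
  evalReversed-elementary []      u = refl
  evalReversed-elementary {suc m} (t ∷ v) u = begin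
    evalReversed (suc m) (linear t ⊛ elementary v) u
      ≡⟨ evalReversed-linear-⊛ m t (elementary v) u ⟩
    (u - + t) * evalReversed m (elementary v) u + elementary v (suc m)
      ≡⟨ cong₂ (λ a b → (u - + t) * a + b) (evalReversed-elementary v u) (elementary-degree v (suc m) ℕₚ.≤-refl) ⟩
    (u - + t) * ∏-diff u v + 0ℤ
      ≡⟨ ℤₚ.+-identityʳ _ ⟩
    ∏-diff u (t ∷ v)
      ∎

  ∏-diff-∈ : ∀ {m u} {v : Vec ℕ m} → u ∈ᵥ v → ∏-diff (+ u) v ≡ 0ℤ
  ∏-diff-∈ {u = u} {t ∷ v} (here refl) = trans (cong (_* ∏-diff (+ u) v) (ℤₚ.+-inverseʳ (+ u))) (ℤₚ.*-zeroˡ (∏-diff (+ u) v))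
  ∏-diff-∈ {u = u} {t ∷ v} (there u∈) = trans (cong ((+ u - + t) *_) (∏-diff-∈ u∈)) (ℤₚ.*-zeroʳ (+ u - + t))


module Congruence (p : ℕ) where

  open import Data.Integer using (ℤ; +_; _+_; _*_; -_; _-_; 0ℤ)
  open import Data.Integer.Tactic.RingSolver using (solve-∀)
  open PowerSeries
  open import Data.Integer.Divisibility.Signed using (_∣_; _∣?_; divides; ∣ᵤ⇒∣; ∣m∣n⇒∣m+n; ∣m∣n⇒∣m-n; ∣m⇒∣-m; ∣n⇒∣m*n)
  open import Data.Integer as ℤ using (_⊖_)
  import Data.Integer.Properties as ℤₚ
  open import Data.Nat.Divisibility using () renaming (_∣_ to _∣ℕ_)
  open import Data.Bool using (T)
  open import Relation.Nullary.Decidable using (toWitness)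
  open import Data.Sum using (inj₁; inj₂)
  open import Relation.Binary.Structures using (IsEquivalence)
  open import Relation.Binary.Bundles using (Setoid)
  import Relation.Binary.Reasoning.Setoid
  import Relation.Nullary.Decidable as Dec
  open import Relation.Binary.Definitions using (Decidable)

  infix 4 _≋_ _≋?_ _≋[_]_

  record _≋_ (a b : ℤ) : Set where
    constructor congruent
    field ∣-difference : + p ∣ a - b
  open _≋_ public

  _≋?_ : Decidable _≋_
  a ≋? b = Dec.map′ congruent ∣-difference (+ p ∣? (a - b))

  ≋-reflexive : ∀ {a b} → a ≡ b → a ≋ b
  ≋-reflexive {a} refl = congruent (divides 0ℤ (cancel a (+ p)))
    where
    cancel : ∀ a P → a - a ≡ 0ℤ * P
    cancel = solve-∀

  ≋-refl : ∀ {a} → a ≋ a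
  ≋-refl = ≋-reflexive refl

  ≋-sym : ∀ {a b} → a ≋ b → b ≋ a
  ≋-sym {a} {b} (congruent a≋b) = congruent (subst (+ p ∣_) (negate a b) (∣m⇒∣-m a≋b))
    where
    negate : ∀ a b → - (a - b) ≡ b - a
    negate = solve-∀

  ≋-trans : ∀ {a b c} → a ≋ b → b ≋ c → a ≋ c
  ≋-trans {a} {b} {c} (congruent a≋b) (congruent b≋c) = congruent (subst (+ p ∣_) (telescope a b c) (∣m∣n⇒∣m+n a≋b b≋c))
    where
    telescope : ∀ a b c → (a - b) + (b - c) ≡ a - c
    telescope = solve-∀

  ≋-isEquivalence : IsEquivalence _≋_
  ≋-isEquivalence = record { refl = ≋-refl ; sym = ≋-sym ; trans = ≋-trans }

  ≋-setoid : Setoid _ _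
  ≋-setoid = record { isEquivalence = ≋-isEquivalence }

  module ≋-Reasoning = Relation.Binary.Reasoning.Setoid ≋-setoid

  +-cong-≋ : ∀ {a b c d} → a ≋ b → c ≋ d → a + c ≋ b + d
  +-cong-≋ {a} {b} {c} {d} (congruent a≋b) (congruent c≋d) = congruent (subst (+ p ∣_) (regroup a b c d) (∣m∣n⇒∣m+n a≋b c≋d))
    where
    regroup : ∀ a b c d → (a - b) + (c - d) ≡ (a + c) - (b + d)
    regroup = solve-∀

  -‿cong-≋ : ∀ {a b c d} → a ≋ b → c ≋ d → a - c ≋ b - d
  -‿cong-≋ {a} {b} {c} {d} (congruent a≋b) (congruent c≋d) = congruent (subst (+ p ∣_) (regroup a b c d) (∣m∣n⇒∣m-n a≋b c≋d))
    where
    regroup : ∀ a b c d → (a - b) - (c - d) ≡ (a - c) - (b - d)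
    regroup = solve-∀

  *-cong-≋ : ∀ {a b c d} → a ≋ b → c ≋ d → a * c ≋ b * d
  *-cong-≋ {a} {b} {c} {d} (congruent a≋b) (congruent c≋d) =
    congruent (subst (+ p ∣_) (regroup a b c d) (∣m∣n⇒∣m+n (∣n⇒∣m*n c a≋b) (∣n⇒∣m*n b c≋d)))
    where
    regroup : ∀ a b c d → c * (a - b) + b * (c - d) ≡ a * c - b * d
    regroup = solve-∀

  ≋0⇒∣ : ∀ {a} → a ≋ 0ℤ → + p ∣ a
  ≋0⇒∣ {a} (congruent a∣) = subst (+ p ∣_) (ℤₚ.+-identityʳ a) a∣

  ∣⇒≋0 : ∀ {a} → + p ∣ a → a ≋ 0ℤ
  ∣⇒≋0 {a} a∣ = congruent (subst (+ p ∣_) (sym (ℤₚ.+-identityʳ a)) a∣)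

  a≋b⇒a-b≋0 : ∀ {a b} → a ≋ b → a - b ≋ 0ℤ
  a≋b⇒a-b≋0 (congruent p∣a-b) = ∣⇒≋0 p∣a-b

  a-b≋0⇒a≋b : ∀ {a b} → a - b ≋ 0ℤ → a ≋ b
  a-b≋0⇒a≋b a-b≋0 = congruent (≋0⇒∣ a-b≋0)

  _≋[_]_ : Series → ℕ → Series → Set
  f ≋[ n ] g = ∀ k → k ℕ.≤ n → f k ≋ g k

  ≗⇒≋[] : ∀ {f g} n → f ≗ g → f ≋[ n ] g
  ≗⇒≋[] n f≗g k _ = ≋-reflexive (f≗g k)

  ≋[]-refl : ∀ {f n} → f ≋[ n ] f
  ≋[]-refl _ _ = ≋-refl

  ≋[]-sym : ∀ {f g n} → f ≋[ n ] g → g ≋[ n ] f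
  ≋[]-sym f≋g k k≤n = ≋-sym (f≋g k k≤n)

  ≋[]-mono : ∀ {f g m n} → m ℕ.≤ n → f ≋[ n ] g → f ≋[ m ] g
  ≋[]-mono m≤n f≋g k k≤m = f≋g k (ℕₚ.≤-trans k≤m m≤n)

  ≋[]-trans : ∀ {f g h n} → f ≋[ n ] g → g ≋[ n ] h → f ≋[ n ] h
  ≋[]-trans f≋g g≋h k k≤n = ≋-trans (f≋g k k≤n) (g≋h k k≤n)

  ⊛-cong-≋ : ∀ {f f′ g g′} k → f ≋[ k ] f′ → g ≋[ k ] g′ → (f ⊛ g) k ≋ (f′ ⊛ g′) k
  ⊛-cong-≋ zero    f≋ g≋ = *-cong-≋ (f≋ 0 ℕ.z≤n) (g≋ 0 ℕ.z≤n)
  ⊛-cong-≋ (suc k) f≋ g≋ = +-cong-≋ (*-cong-≋ (f≋ 0 ℕ.z≤n) (g≋ (suc k) ℕₚ.≤-refl))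
    (⊛-cong-≋ k (λ i i≤k → f≋ (suc i) (ℕ.s≤s i≤k)) (λ i i≤k → g≋ i (ℕₚ.m≤n⇒m≤1+n i≤k)))

  ⊛-cong-≋[] : ∀ {f f′ g g′ n} → f ≋[ n ] f′ → g ≋[ n ] g′ → f ⊛ g ≋[ n ] f′ ⊛ g′
  ⊛-cong-≋[] f≋ g≋ k k≤n = ⊛-cong-≋ k (≋[]-mono k≤n f≋) (≋[]-mono k≤n g≋)

  θ-⊛-logarithmic-≋ : ∀ {F G f g n} → θ f ≋[ n ] F ⊛ f → θ g ≋[ n ] G ⊛ g → θ (f ⊛ g) ≋[ n ] (F ⊕ G) ⊛ (f ⊛ g)
  θ-⊛-logarithmic-≋ {F} {G} {f} {g} θf θg k k≤n = begin
    θ (f ⊛ g) k                          ≡⟨ θ-⊛ f g k ⟩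
    (θ f ⊛ g) k + (f ⊛ θ g) k            ≈⟨ +-cong-≋ (⊛-cong-≋[] θf ≋[]-refl k k≤n) (⊛-cong-≋[] ≋[]-refl θg k k≤n) ⟩
    ((F ⊛ f) ⊛ g) k + (f ⊛ (G ⊛ g)) k    ≡⟨ ⊛-collect F G f g k ⟩
    ((F ⊕ G) ⊛ (f ⊛ g)) k                ∎
    where open ≋-Reasoning

  evalReversed-cong-≋ : ∀ {f g} n u → f ≋[ n ] g → evalReversed n f u ≋ evalReversed n g u
  evalReversed-cong-≋ zero    u f≋g = f≋g 0 ℕ.z≤n
  evalReversed-cong-≋ (suc n) u f≋g =
    +-cong-≋ (*-cong-≋ (≋-refl {u}) (evalReversed-cong-≋ n u (≋[]-mono (ℕₚ.n≤1+n n) f≋g))) (f≋g (suc n) ℕₚ.≤-refl)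

  ≋[]-extend : ∀ {f g k} → f ≋[ k ] g → f (suc k) ≋ g (suc k) → f ≋[ suc k ] g
  ≋[]-extend f≋g fk≋gk i i≤1+k with ℕₚ.m≤n⇒m<n∨m≡n i≤1+k
  ... | inj₁ (ℕ.s≤s i≤k) = f≋g i i≤k
  ... | inj₂ refl        = fk≋gk

  θ-recurrence : ∀ {F A n k} → F 0 ≡ 0ℤ → θ A ≋[ n ] F ⊛ A → suc k ℕ.≤ n → + suc k * A (suc k) ≋ ((F ∘ suc) ⊛ A) k
  θ-recurrence {F} {A} F₀≡0 θA k<n = ≋-trans (θA _ k<n) (≋-reflexive (⊛-suc-constantFree F A _ F₀≡0))

  ∣+m-+n∣≡∣m-n∣ : ∀ m n → ℤ.∣ + m - + n ∣ ≡ ℕ.∣ m - n ∣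
  ∣+m-+n∣≡∣m-n∣ m n = trans (cong ℤ.∣_∣ (ℤₚ.m-n≡m⊖n m n)) (∣m⊖n∣≡∣m-n∣ m n)
    where
    ∣m⊖n∣≡∣m-n∣ : ∀ m n → ℤ.∣ m ⊖ n ∣ ≡ ℕ.∣ m - n ∣
    ∣m⊖n∣≡∣m-n∣ zero    zero    = refl
    ∣m⊖n∣≡∣m-n∣ zero    (suc n) = refl
    ∣m⊖n∣≡∣m-n∣ (suc m) zero    = refl
    ∣m⊖n∣≡∣m-n∣ (suc m) (suc n) = trans (cong ℤ.∣_∣ (ℤₚ.[1+m]⊖[1+n]≡m⊖n m n)) (∣m⊖n∣≡∣m-n∣ m n)

  congB-sound : ∀ {a b} → T (congB p a b) → + a ≋ + b
  congB-sound {a} {b} t = congruent (∣ᵤ⇒∣ (subst (p ∣ℕ_) (sym (∣+m-+n∣≡∣m-n∣ a b)) (toWitness t)))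


module PrimeModulus {p : ℕ} (p-prime : Prime p) where

  open import Data.Integer using (ℤ; +_; _+_; _*_; -_; _-_; 0ℤ; 1ℤ)
  open import Data.Integer.Tactic.RingSolver using (solve-∀)
  open PowerSeries
  open Congruence p
  open import Data.Integer as ℤ using ()
  open import Data.Integer.Divisibility.Signed using (_∣_; divides; ∣⇒∣ᵤ; ∣ᵤ⇒∣)
  import Data.Integer.Properties as ℤₚ
  open import Data.Nat.Divisibility using (∣⇒≤) renaming (_∣_ to _∣ℕ_)
  open import Data.Nat.Primality using (euclidsLemma; prime⇒nonTrivial)
  open import Data.Nat.Coprimality using (coprime⇒GCD≡1; prime⇒coprime)
  import Data.Nat.Coprimality as Coprime
  open import Data.Nat.GCD using (module Bézout; module GCD; GCD)
  open import Data.Sum using (_⊎_; inj₁; inj₂)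
  open import Data.Empty using (⊥-elim)
  open import Relation.Nullary using (¬_)
  open import Data.Vec.Relation.Unary.Any using (Any; here; there)

  euclid-≋0 : ∀ a b → a * b ≋ 0ℤ → a ≋ 0ℤ ⊎ b ≋ 0ℤ
  euclid-≋0 a b ab≋0 with euclidsLemma ℤ.∣ a ∣ ℤ.∣ b ∣ p-prime (subst (p ∣ℕ_) (ℤₚ.abs-* a b) (∣⇒∣ᵤ (≋0⇒∣ ab≋0)))
  ... | inj₁ p∣a = inj₁ (∣⇒≋0 (∣ᵤ⇒∣ p∣a))
  ... | inj₂ p∣b = inj₂ (∣⇒≋0 (∣ᵤ⇒∣ p∣b))

  ≉0-below : ∀ {k} → 0 ℕ.< k → k ℕ.< p → ¬ (+ k ≋ 0ℤ)
  ≉0-below {suc k} _ k<p k≋0 = ℕₚ.<⇒≱ k<p (∣⇒≤ (∣⇒∣ᵤ (≋0⇒∣ k≋0)))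

  1≉0 : ¬ (1ℤ ≋ 0ℤ)
  1≉0 = ≉0-below ℕₚ.≤-refl (ℕ.nonTrivial⇒n>1 p ⦃ prime⇒nonTrivial p-prime ⦄)

  *-cancelˡ-≋ : ∀ {k a b} → 0 ℕ.< k → k ℕ.< p → + k * a ≋ + k * b → a ≋ b
  *-cancelˡ-≋ {k} {a} {b} 0<k k<p ka≋kb with euclid-≋0 (+ k) (a - b) (≋-trans (≋-reflexive (factor (+ k) a b)) (a≋b⇒a-b≋0 ka≋kb))
    where
    factor : ∀ k a b → k * (a - b) ≡ k * a - k * b
    factor = solve-∀
  ... | inj₁ k≋0   = ⊥-elim (≉0-below 0<k k<p k≋0)
  ... | inj₂ a-b≋0 = a-b≋0⇒a≋b a-b≋0

  +-injective-≋ : ∀ {a b} → ℕ.∣ a - b ∣ ℕ.< p → + a ≋ + b → a ≡ b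
  +-injective-≋ {a} {b} ∣a-b∣<p (congruent p∣a-b) with ℕ.∣ a - b ∣ in eq
  ... | zero  = ℕₚ.∣m-n∣≡0⇒m≡n eq
  ... | suc _ = ⊥-elim (ℕₚ.<⇒≱ ∣a-b∣<p (∣⇒≤ (subst (p ∣ℕ_) (trans (∣+m-+n∣≡∣m-n∣ a b) eq) (∣⇒∣ᵤ p∣a-b))))

  ∏-diff-root : ∀ {m} u (v : Vec ℕ m) → ∏-diff u v ≋ 0ℤ → Any (λ x → u ≋ + x) v
  ∏-diff-root u []      1≋0 = ⊥-elim (1≉0 1≋0)
  ∏-diff-root u (t ∷ v) ∏≋0 with euclid-≋0 (u - + t) (∏-diff u v) ∏≋0
  ... | inj₁ u-t≋0 = here (a-b≋0⇒a≋b u-t≋0)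
  ... | inj₂ ∏v≋0  = there (∏-diff-root u v ∏v≋0)

  coprime-below : ∀ {k} → 0 ℕ.< k → k ℕ.< p → GCD k p 1
  coprime-below 0<k k<p = coprime⇒GCD≡1 (Coprime.sym (prime⇒coprime p-prime ⦃ ℕ.>-nonZero 0<k ⦄ k<p))

  inverse : ℕ → ℤ
  inverse k with Bézout.lemma k p
  ... | Bézout.result _ _ (Bézout.+- x _ _) = + x
  ... | Bézout.result _ _ (Bézout.-+ x _ _) = - + x

  inverse-correct : ∀ {k} → 0 ℕ.< k → k ℕ.< p → + k * inverse k ≋ 1ℤ
  inverse-correct {k} 0<k k<p with Bézout.lemma k p
  ... | Bézout.result d g b with GCD.unique g (coprime-below 0<k k<p)
  ...   | refl with b
  ...     | Bézout.+- x y eq = congruent (divides (+ y) (begin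
    + k * + x - 1ℤ               ≡⟨ cong (_- 1ℤ) (trans (ℤₚ.*-comm (+ k) (+ x)) (sym (ℤₚ.pos-* x k))) ⟩
    + (x ℕ.* k) - 1ℤ             ≡⟨ cong (λ n → + n - 1ℤ) (sym eq) ⟩
    + (1 ℕ.+ y ℕ.* p) - 1ℤ       ≡⟨ cong (_- 1ℤ) (trans (ℤₚ.pos-+ 1 (y ℕ.* p)) (cong (_+_ 1ℤ) (ℤₚ.pos-* y p))) ⟩
    1ℤ + + y * + p - 1ℤ          ≡⟨ cancel (+ y) (+ p) ⟩
    + y * + p                    ∎))
    where
    open ≡-Reasoning
    cancel : ∀ y p → 1ℤ + y * p - 1ℤ ≡ y * p
    cancel = solve-∀
  ...     | Bézout.-+ x y eq = congruent (divides (- + y) (begin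
    + k * - + x - 1ℤ             ≡⟨ regroup (+ k) (+ x) ⟩
    - (1ℤ + + x * + k)           ≡⟨ cong -_ (trans (cong (_+_ 1ℤ) (sym (ℤₚ.pos-* x k))) (sym (ℤₚ.pos-+ 1 (x ℕ.* k)))) ⟩
    - + (1 ℕ.+ x ℕ.* k)          ≡⟨ cong (λ n → - + n) eq ⟩
    - + (y ℕ.* p)                ≡⟨ cong -_ (ℤₚ.pos-* y p) ⟩
    - (+ y * + p)                ≡⟨ ℤₚ.neg-distribˡ-* (+ y) (+ p) ⟩
    - + y * + p                  ∎))
    where
    open ≡-Reasoning
    regroup : ∀ k x → k * - x - 1ℤ ≡ - (1ℤ + x * k)
    regroup = solve-∀

  θ-equation-unique : ∀ {F A B n} → n ℕ.< p → F 0 ≡ 0ℤ → A 0 ≋ B 0 →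
                      θ A ≋[ n ] F ⊛ A → θ B ≋[ n ] F ⊛ B → A ≋[ n ] B
  θ-equation-unique {F} {A} {B} {n} n<p F₀≡0 A₀≋B₀ θA θB k k≤n = upTo k k≤n k ℕₚ.≤-refl
    where
    open ≋-Reasoning
    upTo : ∀ k → k ℕ.≤ n → A ≋[ k ] B
    upTo zero    _   zero _ = A₀≋B₀
    upTo (suc k) k<n = ≋[]-extend A≋B (*-cancelˡ-≋ (ℕ.s≤s ℕ.z≤n) (ℕₚ.≤-<-trans k<n n<p) (begin
      + suc k * A (suc k)  ≈⟨ θ-recurrence F₀≡0 θA k<n ⟩
      ((F ∘ suc) ⊛ A) k    ≈⟨ ⊛-cong-≋ k (λ _ _ → ≋-refl) A≋B ⟩
      ((F ∘ suc) ⊛ B) k    ≈⟨ ≋-sym (θ-recurrence F₀≡0 θB k<n) ⟩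
      + suc k * B (suc k)  ∎))
      where
      A≋B = upTo k (ℕₚ.<⇒≤ k<n)

  -- exp n agrees up to degree n with exp (Σₖ Hₖ Tᵏ / k), the solution of θ E = H ⊛ E, E₀ = 1
  module Exponential (H : Series) where

    exp : ℕ → Series
    exp zero            = one
    exp (suc n) zero    = 1ℤ
    exp (suc n) (suc k) = inverse (suc k) * ((H ∘ suc) ⊛ exp n) k

    exp-zero : ∀ n → exp n 0 ≡ 1ℤ
    exp-zero zero    = refl
    exp-zero (suc n) = refl

    exp-stable : ∀ n k → k ℕ.≤ n → exp n k ≡ exp (suc n) k
    exp-stable zero    zero    _           = refl
    exp-stable (suc n) zero    _           = refl
    exp-stable (suc n) (suc k) (ℕ.s≤s k≤n) =
      cong (inverse (suc k) *_) (⊛-congʳ-upTo (H ∘ suc) k (λ i i≤k → exp-stable n i (ℕₚ.≤-trans i≤k k≤n)))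

    θ-exp : H 0 ≡ 0ℤ → ∀ n → n ℕ.< p → θ (exp n) ≋[ n ] H ⊛ exp n
    θ-exp H₀≡0 n       _   zero    _ rewrite H₀≡0 = ≋-refl
    θ-exp H₀≡0 (suc n) n<p (suc k) (ℕ.s≤s k≤n) = begin
      + suc k * (inverse (suc k) * c)          ≡⟨ sym (ℤₚ.*-assoc (+ suc k) (inverse (suc k)) c) ⟩
      + suc k * inverse (suc k) * c
        ≈⟨ *-cong-≋ (inverse-correct (ℕ.s≤s ℕ.z≤n) (ℕₚ.≤-<-trans (ℕ.s≤s k≤n) n<p)) (≋-refl {c}) ⟩
      1ℤ * c                                   ≡⟨ ℤₚ.*-identityˡ c ⟩
      c                                        ≡⟨ ⊛-congʳ-upTo (H ∘ suc) k (λ i i≤k → exp-stable n i (ℕₚ.≤-trans i≤k k≤n)) ⟩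
      ((H ∘ suc) ⊛ exp (suc n)) k              ≡⟨ sym (⊛-suc-constantFree H (exp (suc n)) k H₀≡0) ⟩
      (H ⊛ exp (suc n)) (suc k)                ∎
      where
      open ≋-Reasoning
      c = ((H ∘ suc) ⊛ exp n) k

    exp-first-nonzero : H 0 ≡ 0ℤ → ∀ {ℓ n} → (∀ i → i ℕ.< ℓ → H i ≡ 0ℤ) → ¬ (H ℓ ≋ 0ℤ) →
                        ℓ ℕ.≤ n → n ℕ.< p → ¬ (exp n ℓ ≋ 0ℤ)
    exp-first-nonzero H₀≡0 {ℓ} {n} H<ℓ≡0 Hℓ≉0 ℓ≤n n<p expℓ≋0 = Hℓ≉0 (begin
      H ℓ              ≡⟨ sym (ℤₚ.*-identityʳ (H ℓ)) ⟩
      H ℓ * 1ℤ         ≡⟨ cong (H ℓ *_) (sym (exp-zero n)) ⟩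
      H ℓ * exp n 0    ≡⟨ sym (⊛-vanishing-below H (exp n) ℓ H<ℓ≡0) ⟩
      (H ⊛ exp n) ℓ    ≈⟨ ≋-sym (θ-exp H₀≡0 n n<p ℓ ℓ≤n) ⟩
      + ℓ * exp n ℓ    ≈⟨ *-cong-≋ (≋-refl {+ ℓ}) expℓ≋0 ⟩
      + ℓ * 0ℤ         ≡⟨ ℤₚ.*-zeroʳ (+ ℓ) ⟩
      0ℤ               ∎)
      where open ≋-Reasoning


module Counting where

  open import Data.Nat using (_+_; _*_; _^_; _≤_; z≤n; s≤s)
  open import Data.Nat.Properties
  open import Data.Bool using (true; false; if_then_else_)
  open import Data.List using (List; []; _∷_; _++_; map; concatMap; filter; length; upTo)
  open import Data.List.Membership.Propositional using (_∈_; find)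
  open import Data.List.Membership.Propositional.Properties using (∈-map⁻; ∈-upTo⁻; ∈-concatMap⁻)
  open import Data.List.Relation.Unary.Any using (here; there)
  open import Data.List.Relation.Unary.All using (All; []; _∷_; lookup)
  open import Data.List.Relation.Unary.Unique.Propositional using (Unique; []; _∷_)
  import Data.List.Relation.Unary.Unique.Propositional.Properties as Unique
  open import Data.List.Properties using (length-map; length-upTo)
  open import Data.Product using (_,_)
  open import Data.Vec using (Vec; []; _∷_)
  import Data.Vec.Relation.Unary.All as Vec
  open import Data.Vec.Membership.DecPropositional _≟_ using () renaming (_∈?_ to _∈ᵥ?_)
  open import Relation.Nullary using (Dec; does; _because_; ¬_; _×-dec_; _⊎-dec_)
  open import Relation.Unary using (Pred; Decidable)
  open import Relation.Nullary.Reflects using (invert)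
  open import Data.Empty using (⊥-elim)
  open import Data.Nat.Tactic.RingSolver using (solve-∀)

  ∑ : ∀ {A : Set} → List A → (A → ℕ) → ℕ
  ∑ []       f = 0
  ∑ (x ∷ xs) f = f x + ∑ xs f

  𝟙 : ∀ {P : Set} → Dec P → ℕ
  𝟙 P? = if does P? then 1 else 0

  𝟙≤1 : ∀ {P : Set} (P? : Dec P) → 𝟙 P? ≤ 1
  𝟙≤1 (true  because _) = ≤-refl
  𝟙≤1 (false because _) = z≤n

  𝟙-yes : ∀ {P : Set} (P? : Dec P) → P → 𝟙 P? ≡ 1
  𝟙-yes (true  because _)     _ = refl
  𝟙-yes (false because [¬P]) P  = ⊥-elim (invert [¬P] P)

  𝟙-no : ∀ {P : Set} (P? : Dec P) → ¬ P → 𝟙 P? ≡ 0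
  𝟙-no (true  because [P]) ¬P = ⊥-elim (¬P (invert [P]))
  𝟙-no (false because _)   _  = refl

  𝟙-mono : ∀ {P Q : Set} (P? : Dec P) (Q? : Dec Q) → (P → Q) → 𝟙 P? ≤ 𝟙 Q?
  𝟙-mono (true  because [P]) Q? P⇒Q = ≤-reflexive (sym (𝟙-yes Q? (P⇒Q (invert [P]))))
  𝟙-mono (false because _)   Q? _   = z≤n

  𝟙-× : ∀ {P Q : Set} (P? : Dec P) (Q? : Dec Q) → 𝟙 (P? ×-dec Q?) ≡ 𝟙 P? * 𝟙 Q?
  𝟙-× (true  because _) Q? = sym (+-identityʳ (𝟙 Q?))
  𝟙-× (false because _) Q? = refl

  𝟙-×-≤ˡ : ∀ {P Q : Set} (P? : Dec P) (Q? : Dec Q) → 𝟙 (P? ×-dec Q?) ≤ 𝟙 P?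
  𝟙-×-≤ˡ (true  because _) Q? = 𝟙≤1 Q?
  𝟙-×-≤ˡ (false because _) Q? = z≤n

  𝟙-×-≤ʳ : ∀ {P Q : Set} (P? : Dec P) (Q? : Dec Q) → 𝟙 (P? ×-dec Q?) ≤ 𝟙 Q?
  𝟙-×-≤ʳ (true  because _) Q? = ≤-refl
  𝟙-×-≤ʳ (false because _) Q? = z≤n

  𝟙-⊎ : ∀ {P Q : Set} (P? : Dec P) (Q? : Dec Q) → 𝟙 (P? ⊎-dec Q?) ≤ 𝟙 P? + 𝟙 Q?
  𝟙-⊎ (true  because _) Q? = s≤s z≤n
  𝟙-⊎ (false because _) Q? = ≤-refl

  module _ {A : Set} where

    ∑-cong : ∀ (xs : List A) {f g} → (∀ {x} → x ∈ xs → f x ≡ g x) → ∑ xs f ≡ ∑ xs g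
    ∑-cong []       _   = refl
    ∑-cong (x ∷ xs) f≡g = cong₂ _+_ (f≡g (here refl)) (∑-cong xs (f≡g ∘ there))

    ∑-mono : ∀ (xs : List A) {f g} → (∀ {x} → x ∈ xs → f x ≤ g x) → ∑ xs f ≤ ∑ xs g
    ∑-mono []       _   = z≤n
    ∑-mono (x ∷ xs) f≤g = +-mono-≤ (f≤g (here refl)) (∑-mono xs (f≤g ∘ there))

    ∑-+ : ∀ (xs : List A) f g → ∑ xs (λ x → f x + g x) ≡ ∑ xs f + ∑ xs g
    ∑-+ []       f g = refl
    ∑-+ (x ∷ xs) f g rewrite ∑-+ xs f g = +-assoc-comm (f x) (g x) (∑ xs f) (∑ xs g)
      where
      +-assoc-comm : ∀ a b c d → a + b + (c + d) ≡ a + c + (b + d)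
      +-assoc-comm = solve-∀

    ∑-*ˡ : ∀ (xs : List A) c f → ∑ xs (λ x → c * f x) ≡ c * ∑ xs f
    ∑-*ˡ []       c f = sym (*-zeroʳ c)
    ∑-*ˡ (x ∷ xs) c f rewrite ∑-*ˡ xs c f = sym (*-distribˡ-+ c (f x) (∑ xs f))

    ∑-const : ∀ (xs : List A) c → ∑ xs (λ _ → c) ≡ c * length xs
    ∑-const []       c = sym (*-zeroʳ c)
    ∑-const (x ∷ xs) c rewrite ∑-const xs c = sym (*-suc c (length xs))

    ∑-++ : ∀ (xs ys : List A) f → ∑ (xs ++ ys) f ≡ ∑ xs f + ∑ ys f
    ∑-++ []       ys f = refl
    ∑-++ (x ∷ xs) ys f rewrite ∑-++ xs ys f = sym (+-assoc (f x) (∑ xs f) (∑ ys f))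

    length-filter≡∑𝟙 : ∀ {P : Pred A _} (P? : Decidable P) xs → length (filter P? xs) ≡ ∑ xs (𝟙 ∘ P?)
    length-filter≡∑𝟙 P? []       = refl
    length-filter≡∑𝟙 P? (x ∷ xs) with P? x
    ... | true  because _ = cong suc (length-filter≡∑𝟙 P? xs)
    ... | false because _ = length-filter≡∑𝟙 P? xs

    ∑-𝟙-none : ∀ {P : Pred A _} (P? : Decidable P) xs → (∀ {x} → x ∈ xs → ¬ P x) → ∑ xs (𝟙 ∘ P?) ≡ 0
    ∑-𝟙-none P? xs ¬P = trans (∑-cong xs (λ x∈ → 𝟙-no (P? _) (¬P x∈))) (∑-const xs 0)

    ∑-𝟙-unique : ∀ {P : Pred A _} (P? : Decidable P) {xs} → Unique xs →
                 (∀ {x y} → x ∈ xs → y ∈ xs → P x → P y → x ≡ y) → ∑ xs (𝟙 ∘ P?) ≤ 1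
    ∑-𝟙-unique P? []               _    = z≤n
    ∑-𝟙-unique P? {x ∷ xs} (x∉ ∷ u) uniq with P? x
    ... | true  because [Px] =
      ≤-reflexive (cong suc (∑-𝟙-none P? xs (λ y∈ Py → lookup x∉ y∈ (uniq (here refl) (there y∈) (invert [Px]) Py))))
    ... | false because _    = ∑-𝟙-unique P? u (λ x∈ y∈ → uniq (there x∈) (there y∈))

  module _ {A B : Set} where

    ∑-map : ∀ (xs : List A) (g : A → B) f → ∑ (map g xs) f ≡ ∑ xs (f ∘ g)
    ∑-map []       g f = refl
    ∑-map (x ∷ xs) g f = cong (f (g x) +_) (∑-map xs g f)

    ∑-concatMap : ∀ (xs : List A) (g : A → List B) f → ∑ (concatMap g xs) f ≡ ∑ xs (λ x → ∑ (g x) f)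
    ∑-concatMap []       g f = refl
    ∑-concatMap (x ∷ xs) g f = trans (∑-++ (g x) (concatMap g xs) f) (cong (∑ (g x) f +_) (∑-concatMap xs g f))

    ∑-comm : ∀ (xs : List A) (ys : List B) (f : A → B → ℕ) → ∑ xs (λ x → ∑ ys (f x)) ≡ ∑ ys (λ y → ∑ xs (λ x → f x y))
    ∑-comm []       ys f = sym (∑-const ys 0)
    ∑-comm (x ∷ xs) ys f = trans (cong (∑ ys (f x) +_) (∑-comm xs ys f)) (sym (∑-+ ys (f x) (λ y → ∑ xs (λ x → f x y))))

  range : ℕ → List ℕ
  range N = map suc (upTo N)

  range-unique : ∀ N → Unique (range N)
  range-unique N = Unique.map⁺ suc-injective (Unique.upTo⁺ N)

  length-range : ∀ N → length (range N) ≡ N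
  length-range N = trans (length-map suc (upTo N)) (length-upTo N)

  ∣-∣<-range : ∀ {N t t′} → t ∈ range N → t′ ∈ range N → ℕ.∣ t - t′ ∣ ℕ.< N
  ∣-∣<-range t∈ t′∈ with ∈-map⁻ suc t∈ | ∈-map⁻ suc t′∈
  ... | i , i∈ , refl | j , j∈ , refl = ≤-<-trans (∣m-n∣≤m⊔n i j) (⊔-lub (∈-upTo⁻ i∈) (∈-upTo⁻ j∈))

  ∑-tuples-suc : ∀ m N f → ∑ (tuples (suc m) N) f ≡ ∑ (range N) (λ t → ∑ (tuples m N) (f ∘ (t ∷_)))
  ∑-tuples-suc m N f = trans (∑-concatMap (range N) (λ t → map (t ∷_) (tuples m N)) f)
                             (∑-cong (range N) (λ {t} _ → ∑-map (tuples m N) (t ∷_) f))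

  count-tuples : ∀ m N → ∑ (tuples m N) (λ _ → 1) ≡ N ^ m
  count-tuples zero    N = refl
  count-tuples (suc m) N = begin
    ∑ (tuples (suc m) N) (λ _ → 1)                 ≡⟨ ∑-tuples-suc m N (λ _ → 1) ⟩
    ∑ (range N) (λ _ → ∑ (tuples m N) (λ _ → 1))   ≡⟨ ∑-cong (range N) (λ _ → count-tuples m N) ⟩
    ∑ (range N) (λ _ → N ^ m)                      ≡⟨ ∑-const (range N) (N ^ m) ⟩
    N ^ m * length (range N)                       ≡⟨ cong (N ^ m *_) (length-range N) ⟩
    N ^ m * N                                      ≡⟨ *-comm (N ^ m) N ⟩
    N ^ suc m                                      ∎
    where open ≡-Reasoning

  ∈-tuples⁻ : ∀ {m N v} → v ∈ tuples m N → Vec.All (_∈ range N) v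
  ∈-tuples⁻ {zero}  {v = []} _ = Vec.[]
  ∈-tuples⁻ {suc m} {N} v∈ with find (∈-concatMap⁻ (λ t → map (t ∷_) (tuples m N)) {xs = range N} v∈)
  ... | t , t∈ , v∈t∷ with ∈-map⁻ (t ∷_) v∈t∷
  ...   | w , w∈ , refl = t∈ Vec.∷ ∈-tuples⁻ w∈

  ∑-tuplePairs : ∀ s N f → ∑ (tuplePairs s N) f ≡ ∑ (tuples s N) (λ x → ∑ (tuples s N) (λ y → f (x , y)))
  ∑-tuplePairs s N f = trans (∑-concatMap (tuples s N) (λ x → map (x ,_) (tuples s N)) f)
                             (∑-cong (tuples s N) (λ {x} _ → ∑-map (tuples s N) (x ,_) f))

  ∑-𝟙-∈ᵥ : ∀ {xs m} → Unique xs → (v : Vec ℕ m) → ∑ xs (λ t → 𝟙 (t ∈ᵥ? v)) ≤ m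
  ∑-𝟙-∈ᵥ {xs} u []      = ≤-reflexive (∑-const xs 0)
  ∑-𝟙-∈ᵥ {xs} {suc m} u (a ∷ v) = begin
    ∑ xs (λ t → 𝟙 (t ∈ᵥ? a ∷ v))                       ≤⟨ ∑-mono xs (λ {t} _ → 𝟙-⊎ (t ≟ a) (t ∈ᵥ? v)) ⟩
    ∑ xs (λ t → 𝟙 (t ≟ a) + 𝟙 (t ∈ᵥ? v))               ≡⟨ ∑-+ xs _ _ ⟩
    ∑ xs (λ t → 𝟙 (t ≟ a)) + ∑ xs (λ t → 𝟙 (t ∈ᵥ? v))   ≤⟨ +-mono-≤ (∑-𝟙-unique (_≟ a) u (λ _ _ x≡a y≡a → trans x≡a (sym y≡a)))
                                                                       (∑-𝟙-∈ᵥ u v) ⟩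
    suc m                                                ∎
    where open ≤-Reasoning

  count-entriesIn : ∀ {k} (v : Vec ℕ k) m N → ∑ (tuples m N) (λ z → 𝟙 (Vec.all? (_∈ᵥ? v) z)) ≤ k ^ m
  count-entriesIn {k} v zero    N = ≤-refl
  count-entriesIn {k} v (suc m) N = begin
    ∑ (tuples (suc m) N) (λ z → 𝟙 (Vec.all? (_∈ᵥ? v) z))
      ≡⟨ ∑-tuples-suc m N _ ⟩
    ∑ (range N) (λ t → ∑ (tuples m N) (λ z → 𝟙 (Vec.all? (_∈ᵥ? v) (t ∷ z))))
      ≡⟨ ∑-cong (range N) (λ {t} _ → ∑-cong (tuples m N) (λ {z} _ → 𝟙-× (t ∈ᵥ? v) (Vec.all? (_∈ᵥ? v) z))) ⟩
    ∑ (range N) (λ t → ∑ (tuples m N) (λ z → 𝟙 (t ∈ᵥ? v) * 𝟙 (Vec.all? (_∈ᵥ? v) z)))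
      ≡⟨ ∑-cong (range N) (λ {t} _ → ∑-*ˡ (tuples m N) (𝟙 (t ∈ᵥ? v)) _) ⟩
    ∑ (range N) (λ t → 𝟙 (t ∈ᵥ? v) * ∑ (tuples m N) (λ z → 𝟙 (Vec.all? (_∈ᵥ? v) z)))
      ≤⟨ ∑-mono (range N) (λ {t} _ → *-monoʳ-≤ (𝟙 (t ∈ᵥ? v)) (count-entriesIn v m N)) ⟩
    ∑ (range N) (λ t → 𝟙 (t ∈ᵥ? v) * k ^ m)
      ≡⟨ trans (∑-cong (range N) (λ {t} _ → *-comm (𝟙 (t ∈ᵥ? v)) (k ^ m))) (∑-*ˡ (range N) (k ^ m) _) ⟩
    k ^ m * ∑ (range N) (λ t → 𝟙 (t ∈ᵥ? v))
      ≤⟨ *-monoʳ-≤ (k ^ m) (∑-𝟙-∈ᵥ (range-unique N) v) ⟩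
    k ^ m * k
      ≡⟨ *-comm (k ^ m) k ⟩
    k ^ suc m
      ∎
    where open ≤-Reasoning

  count-tuplePairs : ∀ s N → ∑ (tuplePairs s N) (λ _ → 1) ≡ N ^ s * N ^ s
  count-tuplePairs s N = begin
    ∑ (tuplePairs s N) (λ _ → 1)                      ≡⟨ ∑-tuplePairs s N (λ _ → 1) ⟩
    ∑ (tuples s N) (λ _ → ∑ (tuples s N) (λ _ → 1))   ≡⟨ ∑-cong (tuples s N) (λ _ → count-tuples s N) ⟩
    ∑ (tuples s N) (λ _ → N ^ s)                      ≡⟨ ∑-cong (tuples s N) (λ _ → sym (*-identityʳ (N ^ s))) ⟩
    ∑ (tuples s N) (λ _ → N ^ s * 1)                  ≡⟨ ∑-*ˡ (tuples s N) (N ^ s) (λ _ → 1) ⟩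
    N ^ s * ∑ (tuples s N) (λ _ → 1)                  ≡⟨ cong (N ^ s *_) (count-tuples s N) ⟩
    N ^ s * N ^ s                                     ∎
    where open ≡-Reasoning


module Box {p : ℕ} (p-prime : Prime p) {N : ℕ} (N≤p : N ℕ.≤ p) where

  open import Data.Integer using (ℤ; +_; _+_; _*_; _-_; 0ℤ)
  open import Data.Integer.Tactic.RingSolver using (solve-∀)
  import Data.Nat.Tactic.RingSolver as ℕsolve
  import Data.Integer.Properties as ℤₚ
  open import Data.List.Membership.Propositional using (_∈_)
  open import Data.Sum using (inj₁; inj₂)
  open import Data.Product using (_,_)
  open import Data.Empty using (⊥-elim)
  open import Relation.Nullary using (¬_; _×-dec_; yes; no)
  open PowerSeries
  open Congruence p
  open PrimeModulus p-prime
  open Counting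
  import Data.Vec.Relation.Unary.All as Vec
  open import Data.Vec.Relation.Unary.All.Properties using (lookup⁻)
  open import Data.Vec.Relation.Unary.Any using (Any; here; there)
  open import Data.Vec.Membership.Propositional using () renaming (_∈_ to _∈ᵥ_)
  open import Data.Vec.Membership.Propositional.Properties using (∈-lookup)

  count-linear-roots : ∀ A B → ∑ (range N) (λ t → 𝟙 (A - + t * B ≋? 0ℤ)) ℕ.≤ 1 ℕ.+ N ℕ.* 𝟙 (A ≋? 0ℤ ×-dec B ≋? 0ℤ)
  count-linear-roots A B with B ≋? 0ℤ
  ... | no B≉0 = ℕₚ.≤-trans (∑-𝟙-unique (λ t → A - + t * B ≋? 0ℤ) (range-unique N) unique) (ℕₚ.m≤m+n 1 _)
    where
    difference : ∀ A B t t′ → (A - t * B) - (A - t′ * B) ≡ (t′ - t) * B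
    difference = solve-∀
    unique : ∀ {t t′} → t ∈ range N → t′ ∈ range N → A - + t * B ≋ 0ℤ → A - + t′ * B ≋ 0ℤ → t ≡ t′
    unique {t} {t′} t∈ t′∈ t-root t′-root
      with euclid-≋0 (+ t′ - + t) B (≋-trans (≋-reflexive (sym (difference A B (+ t) (+ t′)))) (-‿cong-≋ t-root t′-root))
    ... | inj₁ t′-t≋0 = sym (+-injective-≋ (ℕₚ.<-≤-trans (∣-∣<-range t′∈ t∈) N≤p) (a-b≋0⇒a≋b t′-t≋0))
    ... | inj₂ B≋0    = ⊥-elim (B≉0 B≋0)
  ... | yes B≋0 with A ≋? 0ℤ
  ...   | no A≉0 = ℕₚ.≤-trans (ℕₚ.≤-reflexive (∑-𝟙-none (λ t → A - + t * B ≋? 0ℤ) (range N) (λ {t} _ → no-root {t}))) ℕ.z≤n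
    where
    no-root : ∀ {t} → ¬ (A - + t * B ≋ 0ℤ)
    no-root {t} root = A≉0 (begin
      A                        ≡⟨ restore A (+ t) B ⟩
      (A - + t * B) + + t * B  ≈⟨ +-cong-≋ root (*-cong-≋ (≋-refl {+ t}) B≋0) ⟩
      0ℤ + + t * 0ℤ            ≡⟨ vanish (+ t) ⟩
      0ℤ                       ∎)
      where
      open ≋-Reasoning
      restore : ∀ A t B → A ≡ (A - t * B) + t * B
      restore = solve-∀
      vanish : ∀ t → 0ℤ + t * 0ℤ ≡ 0ℤ
      vanish = solve-∀
  ...   | yes A≋0 = begin
    ∑ (range N) (λ t → 𝟙 (A - + t * B ≋? 0ℤ))  ≤⟨ ∑-mono (range N) (λ {t} _ → 𝟙≤1 (A - + t * B ≋? 0ℤ)) ⟩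
    ∑ (range N) (λ _ → 1)                        ≡⟨ trans (∑-const (range N) 1) (trans (ℕₚ.*-identityˡ _) (length-range N)) ⟩
    N                                            ≡⟨ sym (ℕₚ.*-identityʳ N) ⟩
    N ℕ.* 1                                      ≡⟨ cong (N ℕ.*_) (sym (𝟙-yes (A ≋? 0ℤ ×-dec B ≋? 0ℤ) (A≋0 , B≋0))) ⟩
    N ℕ.* 𝟙 (A ≋? 0ℤ ×-dec B ≋? 0ℤ)              ≤⟨ ℕₚ.m≤n+m _ 1 ⟩
    1 ℕ.+ N ℕ.* 𝟙 (A ≋? 0ℤ ×-dec B ≋? 0ℤ)        ∎
    where open ℕₚ.≤-Reasoning

  count-vanishing : ∀ E {a} → ¬ (E a ≋ 0ℤ) → ∀ m j → a ℕ.≤ j → j ℕ.≤ m ℕ.+ a →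
                    ∑ (tuples m N) (λ x → 𝟙 ((elementary x ⊛ E) j ≋? 0ℤ)) ℕ.≤ m ℕ.* N ℕ.^ (m ℕ.∸ 1)
  count-vanishing E {a} Ea≉0 zero j a≤j j≤a rewrite ℕₚ.≤-antisym j≤a a≤j =
    ℕₚ.≤-reflexive (cong (ℕ._+ 0) (𝟙-no ((one ⊛ E) a ≋? 0ℤ) (Ea≉0 ∘ ≋-trans (≋-reflexive (sym (⊛-identityˡ E a))))))
  count-vanishing E {a} Ea≉0 (suc m) zero ℕ.z≤n _ =
    ℕₚ.≤-trans (ℕₚ.≤-reflexive (∑-𝟙-none (λ x → (elementary x ⊛ E) 0 ≋? 0ℤ) (tuples (suc m) N) (λ {x} _ → Ea≉0 ∘ ≋-trans (≋-reflexive (sym (E₀ x)))))) ℕ.z≤n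
    where
    E₀ : ∀ x → (elementary x ⊛ E) 0 ≡ E 0
    E₀ x = trans (cong (_* E 0) (elementary-zero x)) (ℤₚ.*-identityˡ (E 0))
  count-vanishing E {a} Ea≉0 (suc m) (suc j) a≤1+j 1+j≤1+m+a = begin
    ∑ (tuples (suc m) N) (λ x → 𝟙 ((elementary x ⊛ E) (suc j) ≋? 0ℤ))
      ≡⟨ ∑-tuples-suc m N _ ⟩
    ∑ (range N) (λ t → ∑ (tuples m N) (λ v → 𝟙 (((linear t ⊛ elementary v) ⊛ E) (suc j) ≋? 0ℤ)))
      ≡⟨ ∑-comm (range N) (tuples m N) _ ⟩
    ∑ (tuples m N) (λ v → ∑ (range N) (λ t → 𝟙 (((linear t ⊛ elementary v) ⊛ E) (suc j) ≋? 0ℤ)))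
      ≡⟨ ∑-cong (tuples m N) (λ {v} _ → ∑-cong (range N) (λ {t} _ → cong (λ c → 𝟙 (c ≋? 0ℤ)) (expand t v))) ⟩
    ∑ (tuples m N) (λ v → ∑ (range N) (λ t → 𝟙 (A v - + t * B v ≋? 0ℤ)))
      ≤⟨ ∑-mono (tuples m N) (λ {v} _ → count-linear-roots (A v) (B v)) ⟩
    ∑ (tuples m N) (λ v → 1 ℕ.+ N ℕ.* 𝟙 (A v ≋? 0ℤ ×-dec B v ≋? 0ℤ))
      ≡⟨ trans (∑-+ (tuples m N) _ _) (cong₂ ℕ._+_ (count-tuples m N) (∑-*ˡ (tuples m N) N _)) ⟩
    N ℕ.^ m ℕ.+ N ℕ.* ∑ (tuples m N) (λ v → 𝟙 (A v ≋? 0ℤ ×-dec B v ≋? 0ℤ))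
      ≤⟨ ℕₚ.+-monoʳ-≤ (N ℕ.^ m) (ℕₚ.*-monoʳ-≤ N both-vanish) ⟩
    N ℕ.^ m ℕ.+ N ℕ.* (m ℕ.* N ℕ.^ (m ℕ.∸ 1))
      ≡⟨ cong (N ℕ.^ m ℕ.+_) (absorb m) ⟩
    N ℕ.^ m ℕ.+ m ℕ.* N ℕ.^ m
      ∎
    where
    open ℕₚ.≤-Reasoning
    A B : ∀ {m} → Vec ℕ m → ℤ
    A v = (elementary v ⊛ E) (suc j)
    B v = (elementary v ⊛ E) j
    expand : ∀ t {m} (v : Vec ℕ m) → ((linear t ⊛ elementary v) ⊛ E) (suc j) ≡ A v - + t * B v
    expand t v = trans (⊛-assoc (linear t) (elementary v) E (suc j)) (linear-⊛ t (elementary v ⊛ E) j)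
    absorb : ∀ m → N ℕ.* (m ℕ.* N ℕ.^ (m ℕ.∸ 1)) ≡ m ℕ.* N ℕ.^ m
    absorb zero    = ℕₚ.*-zeroʳ N
    absorb (suc k) = reassociate N (suc k) (N ℕ.^ k)
      where
      reassociate : ∀ n k x → n ℕ.* (k ℕ.* x) ≡ k ℕ.* (n ℕ.* x)
      reassociate = ℕsolve.solve-∀
    both-vanish : ∑ (tuples m N) (λ v → 𝟙 (A v ≋? 0ℤ ×-dec B v ≋? 0ℤ)) ℕ.≤ m ℕ.* N ℕ.^ (m ℕ.∸ 1)
    both-vanish with suc j ℕ.≤? m ℕ.+ a
    ... | yes 1+j≤m+a = ℕₚ.≤-trans (∑-mono (tuples m N) (λ {v} _ → 𝟙-×-≤ˡ (A v ≋? 0ℤ) (B v ≋? 0ℤ)))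
                                   (count-vanishing E Ea≉0 m (suc j) a≤1+j 1+j≤m+a)
    ... | no  1+j≰m+a = ℕₚ.≤-trans (∑-mono (tuples m N) (λ {v} _ → 𝟙-×-≤ʳ (A v ≋? 0ℤ) (B v ≋? 0ℤ)))
                                   (count-vanishing E Ea≉0 m j a≤j (ℕₚ.≤-pred 1+j≤1+m+a))
      where
      a≤j : a ℕ.≤ j
      a≤j = ℕₚ.≤-trans (ℕₚ.m≤n+m a m) (ℕₚ.≤-pred (ℕₚ.≰⇒> 1+j≰m+a))

  ∈-of-elementary≋ : ∀ {m u} (y z : Vec ℕ m) → Vec.All (_∈ range N) y → u ∈ range N →
                     elementary y ≋[ m ] elementary z → u ∈ᵥ z → u ∈ᵥ y
  ∈-of-elementary≋ {m} {u} y z y∈ u∈ y≋z u∈z = fromRoot y y∈ (∏-diff-root (+ u) y ∏y≋0)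
    where
    ∏y≋0 : ∏-diff (+ u) y ≋ 0ℤ
    ∏y≋0 = begin
      ∏-diff (+ u) y                       ≡⟨ sym (evalReversed-elementary y (+ u)) ⟩
      evalReversed m (elementary y) (+ u)  ≈⟨ evalReversed-cong-≋ m (+ u) y≋z ⟩
      evalReversed m (elementary z) (+ u)  ≡⟨ evalReversed-elementary z (+ u) ⟩
      ∏-diff (+ u) z                       ≡⟨ ∏-diff-∈ u∈z ⟩
      0ℤ                                   ∎
      where open ≋-Reasoning
    fromRoot : ∀ {k} (ys : Vec ℕ k) → Vec.All (_∈ range N) ys → Any (λ x → + u ≋ + x) ys → u ∈ᵥ ys
    fromRoot (y ∷ ys) (y∈ Vec.∷ _)   (here u≋y)   = here (+-injective-≋ (ℕₚ.<-≤-trans (∣-∣<-range u∈ y∈) N≤p) u≋y)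
    fromRoot (y ∷ ys) (_ Vec.∷ ys∈) (there u≋ys) = there (fromRoot ys ys∈ u≋ys)

  entries-determined : ∀ {m} (y z : Vec ℕ m) → Vec.All (_∈ range N) y → Vec.All (_∈ range N) z →
                       elementary y ≋[ m ] elementary z → Vec.All (_∈ᵥ y) z
  entries-determined y z y∈ z∈ y≋z =
    lookup⁻ (λ i → ∈-of-elementary≋ y z y∈ (Vec.lookup z∈ (∈-lookup i z)) y≋z (∈-lookup i z))


module Solutions {p : ℕ} (p-prime : Prime p) {d : ℕ} (d<p : d ℕ.< p) (h : Fin d → Fin p) where

  open import Data.Integer using (+_; _+_; _*_; -_; _-_; 0ℤ; 1ℤ)
  open import Data.Integer.Tactic.RingSolver using (solve-∀)
  import Data.Integer.Properties as ℤₚ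
  open import Data.Fin using (toℕ; fromℕ<)
  open import Data.Fin.Properties using (toℕ-fromℕ<; fromℕ<-toℕ; toℕ<n)
  open import Data.Bool using (T)
  open import Data.Product using (_,_)
  open import Data.Empty using (⊥-elim)
  open import Data.List using (allFin)
  open import Data.List.Relation.Unary.Any using (any?)
  import Data.List.Relation.Unary.All as List
  open import Data.List.Relation.Unary.All.Properties using (all⁺)
  open import Data.List.Membership.Propositional using (find; lose)
  open import Data.List.Membership.Propositional.Properties using (∈-allFin)
  import Data.Vec.Relation.Unary.All as Vec
  open import Data.Vec.Membership.DecPropositional ℕ._≟_ using () renaming (_∈?_ to _∈ᵥ?_)
  open import Relation.Nullary using (¬_; yes; no)
  open import Relation.Nullary.Decidable using (T?)
  open PowerSeries
  open Congruence p
  open PrimeModulus p-prime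
  open Counting

  -- H = Σₖ hₖ Tᵏ; the coefficient hₖ of Tᵏ is h (k - 1), as Fin d is indexed from 0
  H : Series
  H zero = 0ℤ
  H (suc i) with i ℕ.<? d
  ... | yes i<d = + toℕ (h (fromℕ< i<d))
  ... | no  _   = 0ℤ

  H-at : ∀ (j : Fin d) → H (suc (toℕ j)) ≡ + toℕ (h j)
  H-at j with toℕ j ℕ.<? d
  ... | yes j<d = cong (λ i → + toℕ (h i)) (fromℕ<-toℕ j j<d)
  ... | no  j≮d = ⊥-elim (j≮d (toℕ<n j))

  H-below : ∀ (ℓ : Fin d) → (∀ j → toℕ j ℕ.< toℕ ℓ → toℕ (h j) ≡ 0) → ∀ i → i ℕ.< suc (toℕ ℓ) → H i ≡ 0ℤ
  H-below ℓ h<ℓ≡0 zero    _               = refl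
  H-below ℓ h<ℓ≡0 (suc i) (ℕ.s≤s i<ℓ) with i ℕ.<? d
  ... | yes i<d = cong +_ (h<ℓ≡0 (fromℕ< i<d) (subst (ℕ._< toℕ ℓ) (sym (toℕ-fromℕ< i<d)) i<ℓ))
  ... | no  _   = refl

  open Exponential H

  E : Series
  E = exp d

  solves⇒≋ : ∀ {s} (x y : Vec ℕ s) → T (solves d p s h (x , y)) →
             ∀ j → + powSum (suc (toℕ j)) x ≋ + (powSum (suc (toℕ j)) y ℕ.+ toℕ (h j))
  solves⇒≋ x y sol j = congB-sound (List.lookup (all⁺ _ (allFin d) sol) (∈-allFin j))

  solves⇒negPowerSums≋ : ∀ {s} (x y : Vec ℕ s) → T (solves d p s h (x , y)) →
                         negPowerSums y ≋[ d ] negPowerSums x ⊕ H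
  solves⇒negPowerSums≋ x y sol zero _ = ≋-refl
  solves⇒negPowerSums≋ x y sol (suc i) i<d with i ℕ.<? d
  ... | no i≮d  = ⊥-elim (i≮d i<d)
  ... | yes i<d′ = move (subst (λ k → + powSum (suc k) x ≋ + (powSum (suc k) y ℕ.+ toℕ (h (fromℕ< i<d′))))
                               (toℕ-fromℕ< i<d′) (solves⇒≋ x y sol (fromℕ< i<d′)))
    where
    move : ∀ {a b c} → + a ≋ + (b ℕ.+ c) → - + b ≋ - + a + + c
    move {a} {b} {c} a≋b+c = begin
      - + b                               ≡⟨ regroup (+ a) (+ b) (+ c) ⟩
      (- + a + + c) + (+ a - (+ b + + c)) ≈⟨ +-cong-≋ (≋-refl { - + a + + c})
                                                      (a≋b⇒a-b≋0 (≋-trans a≋b+c (≋-reflexive (ℤₚ.pos-+ b c)))) ⟩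
      (- + a + + c) + 0ℤ                  ≡⟨ ℤₚ.+-identityʳ _ ⟩
      - + a + + c                         ∎
      where
      open ≋-Reasoning
      regroup : ∀ a b c → - b ≡ (- a + c) + (a - (b + c))
      regroup = solve-∀

  solves⇒elementary≋ : ∀ {s} (x y : Vec ℕ s) → T (solves d p s h (x , y)) → elementary y ≋[ d ] elementary x ⊛ E
  solves⇒elementary≋ x y sol = θ-equation-unique d<p refl y₀≋W₀ θy θW
    where
    y₀≋W₀ : elementary y 0 ≋ (elementary x ⊛ E) 0
    y₀≋W₀ = ≋-reflexive (begin
      elementary y 0                 ≡⟨ elementary-zero y ⟩
      1ℤ                             ≡⟨⟩
      1ℤ * 1ℤ                        ≡⟨ sym (cong₂ _*_ (elementary-zero x) (exp-zero d)) ⟩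
      elementary x 0 * E 0           ∎)
      where open ≡-Reasoning
    θy : θ (elementary y) ≋[ d ] (negPowerSums x ⊕ H) ⊛ elementary y
    θy = ≋[]-trans (≗⇒≋[] d (newton y)) (⊛-cong-≋[] (solves⇒negPowerSums≋ x y sol) ≋[]-refl)
    θW : θ (elementary x ⊛ E) ≋[ d ] (negPowerSums x ⊕ H) ⊛ (elementary x ⊛ E)
    θW = θ-⊛-logarithmic-≋ (≗⇒≋[] d (newton x)) (θ-exp refl d d<p)

  E-first-nonzero : ∀ (ℓ : Fin d) → toℕ (h ℓ) ≢ 0 → (∀ j → toℕ j ℕ.< toℕ ℓ → toℕ (h j) ≡ 0) →
                    ¬ (E (suc (toℕ ℓ)) ≋ 0ℤ)
  E-first-nonzero ℓ hℓ≢0 h<ℓ≡0 = exp-first-nonzero refl (H-below ℓ h<ℓ≡0) Hℓ≉0 (toℕ<n ℓ) d<p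
    where
    Hℓ≉0 : ¬ (H (suc (toℕ ℓ)) ≋ 0ℤ)
    Hℓ≉0 Hℓ≋0 = ≉0-below (ℕₚ.n≢0⇒n>0 hℓ≢0) (toℕ<n (h ℓ)) (subst (_≋ 0ℤ) (H-at ℓ) Hℓ≋0)

  module _ {N : ℕ} (N≤p : N ℕ.≤ p) where

    open Box p-prime N≤p

    count-solutions-at : ∀ {s j} → s ℕ.< j → j ℕ.≤ d → (x : Vec ℕ s) →
      ∑ (tuples s N) (λ y → 𝟙 (T? (solves d p s h (x , y)))) ℕ.≤ 𝟙 ((elementary x ⊛ E) j ≋? 0ℤ) ℕ.* s ℕ.^ s
    count-solutions-at {s} {j} s<j j≤d x with any? (λ y → T? (solves d p s h (x , y))) (tuples s N)
    ... | no ¬sol = ℕₚ.≤-trans (ℕₚ.≤-reflexive (∑-𝟙-none (λ y → T? (solves d p s h (x , y))) (tuples s N) (λ y∈ sol → ¬sol (lose y∈ sol)))) ℕ.z≤n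
    ... | yes sol with find sol
    ...   | y₀ , y₀∈ , sol₀ = begin
      ∑ (tuples s N) (λ y → 𝟙 (T? (solves d p s h (x , y))))
        ≤⟨ ∑-mono (tuples s N) (λ {z} z∈ → 𝟙-mono (T? _) (Vec.all? (_∈ᵥ? y₀) z) (λ solz →
             entries-determined y₀ z (∈-tuples⁻ y₀∈) (∈-tuples⁻ z∈) (same-elementary z solz))) ⟩
      ∑ (tuples s N) (λ z → 𝟙 (Vec.all? (_∈ᵥ? y₀) z))
        ≤⟨ count-entriesIn y₀ s N ⟩
      s ℕ.^ s
        ≡⟨ sym (ℕₚ.*-identityˡ (s ℕ.^ s)) ⟩
      1 ℕ.* s ℕ.^ s
        ≡⟨ cong (ℕ._* s ℕ.^ s) (sym (𝟙-yes ((elementary x ⊛ E) j ≋? 0ℤ) Wj≋0)) ⟩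
      𝟙 ((elementary x ⊛ E) j ≋? 0ℤ) ℕ.* s ℕ.^ s
        ∎
      where
      open ℕₚ.≤-Reasoning
      same-elementary : ∀ z → T (solves d p s h (x , z)) → elementary y₀ ≋[ s ] elementary z
      same-elementary z solz = ≋[]-mono (ℕₚ.<⇒≤ (ℕₚ.<-≤-trans s<j j≤d))
        (≋[]-trans (solves⇒elementary≋ x y₀ sol₀) (≋[]-sym (solves⇒elementary≋ x z solz)))
      Wj≋0 : (elementary x ⊛ E) j ≋ 0ℤ
      Wj≋0 = ≋-trans (≋-sym (solves⇒elementary≋ x y₀ sol₀ j j≤d)) (≋-reflexive (elementary-degree y₀ j s<j))

    R-bound : ∀ {s} → s ℕ.< d → ∀ ℓ → toℕ (h ℓ) ≢ 0 → (∀ j → toℕ j ℕ.< toℕ ℓ → toℕ (h j) ≡ 0) →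
              R d s N p h ℕ.≤ s ℕ.^ s ℕ.* (s ℕ.* N ℕ.^ (s ℕ.∸ 1))
    R-bound {s} s<d ℓ hℓ≢0 h<ℓ≡0 = begin
      R d s N p h
        ≡⟨ length-filter≡∑𝟙 (λ xy → T? (solves d p s h xy)) (tuplePairs s N) ⟩
      ∑ (tuplePairs s N) (λ xy → 𝟙 (T? (solves d p s h xy)))
        ≡⟨ ∑-tuplePairs s N _ ⟩
      ∑ (tuples s N) (λ x → ∑ (tuples s N) (λ y → 𝟙 (T? (solves d p s h (x , y)))))
        ≤⟨ ∑-mono (tuples s N) (λ {x} _ → count-solutions-at s<j₀ j₀≤d x) ⟩
      ∑ (tuples s N) (λ x → 𝟙 ((elementary x ⊛ E) j₀ ≋? 0ℤ) ℕ.* s ℕ.^ s)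
        ≡⟨ trans (∑-cong (tuples s N) (λ {x} _ → ℕₚ.*-comm _ (s ℕ.^ s))) (∑-*ˡ (tuples s N) (s ℕ.^ s) _) ⟩
      s ℕ.^ s ℕ.* ∑ (tuples s N) (λ x → 𝟙 ((elementary x ⊛ E) j₀ ≋? 0ℤ))
        ≤⟨ ℕₚ.*-monoʳ-≤ (s ℕ.^ s) (count-vanishing E (E-first-nonzero ℓ hℓ≢0 h<ℓ≡0) s j₀ ℓ≤j₀ j₀≤s+ℓ) ⟩
      s ℕ.^ s ℕ.* (s ℕ.* N ℕ.^ (s ℕ.∸ 1))
        ∎
      where
      open ℕₚ.≤-Reasoning
      ℓ′ = suc (toℕ ℓ)
      -- s < j₀ ≤ d makes this coefficient vanish for solutions, ℓ′ ≤ j₀ ≤ s + ℓ′ lets count-vanishing apply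
      j₀ = ℓ′ ℕ.⊔ suc s
      s<j₀ : s ℕ.< j₀
      s<j₀ = ℕₚ.m≤n⊔m ℓ′ (suc s)
      j₀≤d : j₀ ℕ.≤ d
      j₀≤d = ℕₚ.⊔-lub (toℕ<n ℓ) s<d
      ℓ≤j₀ : ℓ′ ℕ.≤ j₀
      ℓ≤j₀ = ℕₚ.m≤m⊔n ℓ′ (suc s)
      j₀≤s+ℓ : j₀ ℕ.≤ s ℕ.+ ℓ′
      j₀≤s+ℓ = ℕₚ.⊔-lub (ℕₚ.m≤n+m ℓ′ s)
                        (ℕₚ.≤-trans (ℕ.s≤s (ℕₚ.m≤m+n s (toℕ ℓ))) (ℕₚ.≤-reflexive (sym (ℕₚ.+-suc s (toℕ ℓ)))))


module Arithmetic where

  open import Data.Nat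
  open import Data.Nat.Properties
  open import Data.Nat.Tactic.RingSolver using (solve-∀)

  ^-mono-≤ : ∀ {a b m n} .{{_ : NonZero b}} → a ≤ b → m ≤ n → a ^ m ≤ b ^ n
  ^-mono-≤ {a} {b} {m} a≤b m≤n = ≤-trans (^-monoˡ-≤ m a≤b) (^-monoʳ-≤ b m≤n)

  square-* : ∀ a b → (a * b) ^ 2 ≡ a ^ 2 * b ^ 2
  square-* a b = expand a b
    where
    expand : ∀ a b → a * b * (a * b * 1) ≡ a * (a * 1) * (b * (b * 1))
    expand = solve-∀

  square-bound : ∀ {d s N r} .{{_ : NonZero d}} .{{_ : NonZero N}} → s ≤ d →
                 r ≤ s ^ s * (s * N ^ (s ∸ 1)) → r ^ 2 ≤ (d ^ suc d) ^ 2 * N ^ (2 * s ∸ 1)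
  square-bound {d} {s} {N} {r} s≤d r≤ = begin
    r ^ 2                                    ≤⟨ ^-monoˡ-≤ 2 r≤ ⟩
    (s ^ s * (s * N ^ (s ∸ 1))) ^ 2          ≡⟨ cong (_^ 2) (reassociate (s ^ s) s (N ^ (s ∸ 1))) ⟩
    (s ^ suc s * N ^ (s ∸ 1)) ^ 2            ≤⟨ ^-monoˡ-≤ 2 (*-monoˡ-≤ (N ^ (s ∸ 1)) (^-mono-≤ s≤d (s≤s s≤d))) ⟩
    (d ^ suc d * N ^ (s ∸ 1)) ^ 2            ≡⟨ square-* (d ^ suc d) (N ^ (s ∸ 1)) ⟩
    (d ^ suc d) ^ 2 * (N ^ (s ∸ 1)) ^ 2      ≡⟨ cong ((d ^ suc d) ^ 2 *_) (^-*-assoc N (s ∸ 1) 2) ⟩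
    (d ^ suc d) ^ 2 * N ^ ((s ∸ 1) * 2)      ≤⟨ *-monoʳ-≤ ((d ^ suc d) ^ 2) (^-monoʳ-≤ N (exponent s)) ⟩
    (d ^ suc d) ^ 2 * N ^ (2 * s ∸ 1)        ∎
    where
    open ≤-Reasoning
    reassociate : ∀ a s x → a * (s * x) ≡ s * a * x
    reassociate = solve-∀
    exponent : ∀ s → (s ∸ 1) * 2 ≤ 2 * s ∸ 1
    exponent zero    = z≤n
    exponent (suc t) = ≤-trans (n≤1+n (t * 2)) (≤-reflexive (double t))
      where
      double : ∀ t → suc (t * 2) ≡ t + suc (t + 0)
      double = solve-∀

  trivial-square-bound : ∀ {d s N r} .{{_ : NonZero d}} .{{_ : NonZero N}} → N ≤ d → s ≤ d →
                         r ≤ N ^ s * N ^ s → r ^ 2 ≤ (d ^ suc d) ^ 2 * N ^ (2 * s ∸ 1)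
  trivial-square-bound {d} {s} {N} {r} N≤d s≤d r≤ = begin
    r ^ 2                                           ≤⟨ ^-monoˡ-≤ 2 r≤ ⟩
    (N ^ s * N ^ s) ^ 2                             ≡⟨ cong (_^ 2) (sym (^-distribˡ-+-* N s s)) ⟩
    (N ^ (s + s)) ^ 2                               ≡⟨ ^-*-assoc N (s + s) 2 ⟩
    N ^ ((s + s) * 2)                               ≤⟨ ^-monoʳ-≤ N (exponent s) ⟩
    N ^ ((2 * s ∸ 1) + (2 * s + 1))                 ≡⟨ ^-distribˡ-+-* N (2 * s ∸ 1) (2 * s + 1) ⟩
    N ^ (2 * s ∸ 1) * N ^ (2 * s + 1)               ≤⟨ *-monoʳ-≤ (N ^ (2 * s ∸ 1)) (^-mono-≤ N≤d (exponent′ s≤d)) ⟩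
    N ^ (2 * s ∸ 1) * d ^ (suc d * 2)               ≡⟨ cong (N ^ (2 * s ∸ 1) *_) (sym (^-*-assoc d (suc d) 2)) ⟩
    N ^ (2 * s ∸ 1) * (d ^ suc d) ^ 2               ≡⟨ *-comm (N ^ (2 * s ∸ 1)) ((d ^ suc d) ^ 2) ⟩
    (d ^ suc d) ^ 2 * N ^ (2 * s ∸ 1)               ∎
    where
    open ≤-Reasoning
    exponent : ∀ s → (s + s) * 2 ≤ (2 * s ∸ 1) + (2 * s + 1)
    exponent zero    = z≤n
    exponent (suc t) = ≤-reflexive (expand t)
      where
      expand : ∀ t → (suc t + suc t) * 2 ≡ (t + suc (t + 0)) + (2 * suc t + 1)
      expand = solve-∀
    exponent′ : s ≤ d → 2 * s + 1 ≤ suc d * 2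
    exponent′ s≤d = ≤-trans (+-monoˡ-≤ 1 (*-monoʳ-≤ 2 s≤d)) (≤-trans (+-monoʳ-≤ (2 * d) (s≤s z≤n)) (≤-reflexive (expand d)))
      where
      expand : ∀ d → 2 * d + 2 ≡ suc d * 2
      expand = solve-∀


open import Data.Nat using (_*_; _^_; _≤_; _<_; _∸_; NonZero)
open import Data.Fin using (toℕ)
open import Data.Product using (Σ; _×_; _,_)
open import Data.Sum using ([_,_]′)
open import Relation.Nullary.Decidable using (T?)
open Counting
open Arithmetic

R-trivial : ∀ d s N p (h : Fin d → Fin p) → R d s N p h ≤ N ^ s * N ^ s
R-trivial d s N p h = begin
  R d s N p h
    ≡⟨ length-filter≡∑𝟙 (λ xy → T? (solves d p s h xy)) (tuplePairs s N) ⟩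
  ∑ (tuplePairs s N) (λ xy → 𝟙 (T? (solves d p s h xy)))
    ≤⟨ ∑-mono (tuplePairs s N) (λ {xy} _ → 𝟙≤1 (T? (solves d p s h xy))) ⟩
  ∑ (tuplePairs s N) (λ _ → 1)
    ≡⟨ count-tuplePairs s N ⟩
  N ^ s * N ^ s
    ∎
  where open ℕₚ.≤-Reasoning

R²-bound : ∀ {d p N s} (h : Fin d → Fin p) → Prime p → 1 ≤ N → N ≤ p → s < d →
           ∀ ℓ → toℕ (h ℓ) ≢ 0 → (∀ j → toℕ j < toℕ ℓ → toℕ (h j) ≡ 0) →
           R d s N p h ^ 2 ≤ (d ^ suc d) ^ 2 * N ^ (2 * s ∸ 1)
R²-bound {d} {p} {N} {s} h p-prime 1≤N N≤p s<d ℓ hℓ≢0 h<ℓ≡0 =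
  [ (λ p≤d → trivial-square-bound (ℕₚ.≤-trans N≤p p≤d) s≤d (R-trivial d s N p h))
  , (λ d<p → square-bound s≤d (Solutions.R-bound p-prime d<p h N≤p s<d ℓ hℓ≢0 h<ℓ≡0))
  ]′ (ℕₚ.≤-<-connex p d)
  where
  s≤d = ℕₚ.<⇒≤ s<d
  instance
    d≢0 : NonZero d
    d≢0 = ℕ.>-nonZero (ℕₚ.≤-<-trans ℕ.z≤n s<d)
    N≢0 : NonZero N
    N≢0 = ℕ.>-nonZero 1≤N

-- The argument does not use the hypotheses 3 ≤ d, 1 ≤ s and ℓ + 1 < d.
lemma2p5 : (d : ℕ) → 3 ≤ d →
    Σ ℕ λ C → ∀ (p N s : ℕ) (h : Fin d → Fin p) → Prime p →
      1 ≤ N → N ≤ p →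
      (Σ (Fin d) λ ℓ → (toℕ (h ℓ) ≢ 0) × (∀ j → toℕ j < toℕ ℓ → toℕ (h j) ≡ 0) × (suc (toℕ ℓ) < d)) →
      1 ≤ s → s < d →
      R d s N p h ^ 2 ≤ C * N ^ (2 * s ∸ 1)
lemma2p5 d _ = (d ^ suc d) ^ 2 , λ p N s h p-prime 1≤N N≤p (ℓ , hℓ≢0 , h<ℓ≡0 , _) _ s<d →
  R²-bound h p-prime 1≤N N≤p s<d ℓ hℓ≢0 h<ℓ≡0
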